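{- Every $I$-cellular CwF is contextual.
   Context: A CwF consists of a category with terminal object $\diamond$, a presheaf $\mathsf{Ty}$ of types, sets $\mathsf{Tm}(\Gamma,A)$ of terms with functorial substitution, and context extensions $\Gamma.A$ representing pairs of a substitution into $\Gamma$ and a term of $A$. A closed telescope is a finite sequence $A_1\in\mathsf{Ty}(\diamond)$, $A_2\in\mathsf{Ty}(\diamond.A_1)$, \dots, $A_n\in\mathsf{Ty}(\diamond.A_1.\cdots.A_{n-1})$; each determines the object $\diamond.A_1.\cdots.A_n$. The CwF is contextual if this map from closed telescopes to objects is a bijection. $I$-cellular CwF: let $I^{\mathsf{ty}}$ be the CwF morphism from the CwF freely generated by an object $\boldsymbol{\Gamma}$ to the CwF freely generated by an object $\boldsymbol{\Gamma}$ and a type $\boldsymbol{A}$ over it, and $I^{\mathsf{tm}}$ the morphism from the latter to the CwF freely generated by $\boldsymbol{\Gamma}$, $\boldsymbol{A}$ and a term $\boldsymbol{a}$ of type $\boldsymbol{A}$. A basic $I$-cellular map is a pushout (in the category of CwFs and strict morphisms) of a coproduct of copies of $I^{\mathsf{ty}}$ and $I^{\mathsf{tm}}$; an $I$-cellular map is a composite of a countable sequence of basic $I$-cellular maps; a CwF $\mathcal{C}$ is $I$-cellular if the unique map from the initial CwF to $\mathcal{C}$ is $I$-cellular. -}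

module Defs where

open import Level using (0ℓ)
open import Data.Nat using (ℕ; zero; suc)
open import Data.Product using (Σ; Σ-syntax; _×_; _,_; proj₁)
open import Relation.Binary.PropositionalEquality using (_≡_; subst; sym)
open import Relation.Binary.HeterogeneousEquality using (_≅_)
open import Function.Definitions using (Bijective)

record CwF : Set₁ where
  infixl 9 _∘_
  infixl 8 _[_]T _[_]t
  infixl 7 _▹_
  field
    Ob   : Set
    Hom  : Ob → Ob → Set
    id   : ∀ {Γ} → Hom Γ Γ
    _∘_  : ∀ {Γ Δ Θ} → Hom Δ Θ → Hom Γ Δ → Hom Γ Θ
    idl  : ∀ {Γ Δ} (σ : Hom Γ Δ) → id ∘ σ ≡ σ
    idr  : ∀ {Γ Δ} (σ : Hom Γ Δ) → σ ∘ id ≡ σ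
    ass  : ∀ {Γ Δ Θ Ξ} (σ : Hom Θ Ξ) (τ : Hom Δ Θ) (ν : Hom Γ Δ) →
           (σ ∘ τ) ∘ ν ≡ σ ∘ (τ ∘ ν)
    ◇    : Ob
    !    : ∀ {Γ} → Hom Γ ◇
    !-η  : ∀ {Γ} (σ : Hom Γ ◇) → σ ≡ !
    Ty     : Ob → Set
    _[_]T  : ∀ {Γ Δ} → Ty Δ → Hom Γ Δ → Ty Γ
    [id]T  : ∀ {Γ} (A : Ty Γ) → A [ id ]T ≡ A
    [∘]T   : ∀ {Γ Δ Θ} (A : Ty Θ) (σ : Hom Δ Θ) (τ : Hom Γ Δ) →
             A [ σ ∘ τ ]T ≡ A [ σ ]T [ τ ]T
    Tm     : (Γ : Ob) → Ty Γ → Set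
    _[_]t  : ∀ {Γ Δ} {A : Ty Δ} → Tm Δ A → (σ : Hom Γ Δ) → Tm Γ (A [ σ ]T)
    [id]t  : ∀ {Γ} {A : Ty Γ} (t : Tm Γ A) → t [ id ]t ≅ t
    [∘]t   : ∀ {Γ Δ Θ} {A : Ty Θ} (t : Tm Θ A) (σ : Hom Δ Θ) (τ : Hom Γ Δ) →
             t [ σ ∘ τ ]t ≅ t [ σ ]t [ τ ]t
    _▹_    : (Γ : Ob) → Ty Γ → Ob
    p      : ∀ {Γ} {A : Ty Γ} → Hom (Γ ▹ A) Γ
    q      : ∀ {Γ} {A : Ty Γ} → Tm (Γ ▹ A) (A [ p ]T)
    ⟨_,_⟩  : ∀ {Γ Δ} {A : Ty Γ} (σ : Hom Δ Γ) → Tm Δ (A [ σ ]T) → Hom Δ (Γ ▹ A)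
    ▹β₁    : ∀ {Γ Δ} {A : Ty Γ} (σ : Hom Δ Γ) (t : Tm Δ (A [ σ ]T)) →
             p ∘ ⟨ σ , t ⟩ ≡ σ
    ▹β₂    : ∀ {Γ Δ} {A : Ty Γ} (σ : Hom Δ Γ) (t : Tm Δ (A [ σ ]T)) →
             q [ ⟨ σ , t ⟩ ]t ≅ t
    ▹η     : ∀ {Γ Δ} {A : Ty Γ} (τ : Hom Δ (Γ ▹ A)) →
             ⟨ p ∘ τ , subst (Tm Δ) (sym ([∘]T A p τ)) (q [ τ ]t) ⟩ ≡ τ

open CwF

record RawMap (C D : CwF) : Set where
  field
    ob  : Ob C → Ob D
    hom : ∀ {Γ Δ} → Hom C Γ Δ → Hom D (ob Γ) (ob Δ)
    ty  : ∀ {Γ} → Ty C Γ → Ty D (ob Γ)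
    tm  : ∀ {Γ} {A : Ty C Γ} → Tm C Γ A → Tm D (ob Γ) (ty A)

_∘R_ : ∀ {C D E} → RawMap D E → RawMap C D → RawMap C E
G ∘R F = record
  { ob  = λ Γ → RawMap.ob G (RawMap.ob F Γ)
  ; hom = λ σ → RawMap.hom G (RawMap.hom F σ)
  ; ty  = λ A → RawMap.ty G (RawMap.ty F A)
  ; tm  = λ t → RawMap.tm G (RawMap.tm F t) }

record _≈R_ {C D : CwF} (F G : RawMap C D) : Set where
  field
    ob≈  : ∀ Γ → RawMap.ob F Γ ≡ RawMap.ob G Γ
    hom≈ : ∀ {Γ Δ} (σ : Hom C Γ Δ) → RawMap.hom F σ ≅ RawMap.hom G σ
    ty≈  : ∀ {Γ} (A : Ty C Γ) → RawMap.ty F A ≅ RawMap.ty G A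
    tm≈  : ∀ {Γ} {A : Ty C Γ} (t : Tm C Γ A) → RawMap.tm F t ≅ RawMap.tm G t

record _⇒_ (C D : CwF) : Set where
  field
    raw   : RawMap C D
  open RawMap raw
  field
    hom-id : ∀ {Γ} → hom (id C {Γ}) ≡ id D
    hom-∘  : ∀ {Γ Δ Θ} (σ : Hom C Δ Θ) (τ : Hom C Γ Δ) →
             hom (_∘_ C σ τ) ≡ _∘_ D (hom σ) (hom τ)
    ob-◇   : ob (◇ C) ≡ ◇ D
    ty-[]  : ∀ {Γ Δ} (A : Ty C Δ) (σ : Hom C Γ Δ) →
             ty (_[_]T C A σ) ≡ _[_]T D (ty A) (hom σ)
    tm-[]  : ∀ {Γ Δ} {A : Ty C Δ} (t : Tm C Δ A) (σ : Hom C Γ Δ) →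
             tm (_[_]t C t σ) ≅ _[_]t D (tm t) (hom σ)
    ob-▹   : ∀ Γ (A : Ty C Γ) → ob (_▹_ C Γ A) ≡ _▹_ D (ob Γ) (ty A)
    hom-p  : ∀ {Γ} {A : Ty C Γ} → hom (p C {Γ} {A}) ≅ p D {ob Γ} {ty A}
    tm-q   : ∀ {Γ} {A : Ty C Γ} → tm (q C {Γ} {A}) ≅ q D {ob Γ} {ty A}
    hom-⟨⟩ : ∀ {Γ Δ} {A : Ty C Γ} (σ : Hom C Δ Γ) (t : Tm C Δ (_[_]T C A σ)) →
             hom (⟨_,_⟩ C σ t) ≅ ⟨_,_⟩ D (hom σ) (subst (Tm D (ob Δ)) (ty-[] A σ) (tm t))

open _⇒_
open RawMap

Tri : ∀ {A B C} → B ⇒ C → A ⇒ B → A ⇒ C → Set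
Tri h f g = (raw h ∘R raw f) ≈R raw g

Sq : ∀ {A B C D} → B ⇒ D → A ⇒ B → C ⇒ D → A ⇒ C → Set
Sq h f k g = (raw h ∘R raw f) ≈R (raw k ∘R raw g)

IsInitial : CwF → Set₁
IsInitial Z = (E : CwF) → Σ (Z ⇒ E) λ h → (h' : Z ⇒ E) → raw h' ≈R raw h

IsFreeOb : (F : CwF) → Ob F → Set₁
IsFreeOb F Γ₀ = (E : CwF) (Δ : Ob E) →
  Σ (F ⇒ E) λ h → (ob (raw h) Γ₀ ≡ Δ)
    × ((h' : F ⇒ E) → ob (raw h') Γ₀ ≡ Δ → raw h' ≈R raw h)

IsFreeTy : (F : CwF) (Γ₀ : Ob F) → Ty F Γ₀ → Set₁
IsFreeTy F Γ₀ A₀ = (E : CwF) (Δ : Ob E) (B : Ty E Δ) →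
  Σ (F ⇒ E) λ h → (ob (raw h) Γ₀ ≡ Δ) × (ty (raw h) A₀ ≅ B)
    × ((h' : F ⇒ E) → ob (raw h') Γ₀ ≡ Δ → ty (raw h') A₀ ≅ B → raw h' ≈R raw h)

IsFreeTm : (F : CwF) (Γ₀ : Ob F) (A₀ : Ty F Γ₀) → Tm F Γ₀ A₀ → Set₁
IsFreeTm F Γ₀ A₀ a₀ = (E : CwF) (Δ : Ob E) (B : Ty E Δ) (b : Tm E Δ B) →
  Σ (F ⇒ E) λ h → (ob (raw h) Γ₀ ≡ Δ) × (ty (raw h) A₀ ≅ B) × (tm (raw h) a₀ ≅ b)
    × ((h' : F ⇒ E) → ob (raw h') Γ₀ ≡ Δ → ty (raw h') A₀ ≅ B → tm (raw h') a₀ ≅ b →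
       raw h' ≈R raw h)

record IsCoproduct {J : Set} (X : J → CwF) (P : CwF) (ι : ∀ j → X j ⇒ P) : Set₁ where
  field
    univ : (E : CwF) (g : ∀ j → X j ⇒ E) →
           Σ (P ⇒ E) λ h → (∀ j → Tri h (ι j) (g j))
             × ((h' : P ⇒ E) → (∀ j → Tri h' (ι j) (g j)) → raw h' ≈R raw h)

record IsPushout {A B C P : CwF} (f : A ⇒ B) (g : A ⇒ C)
                 (i₁ : B ⇒ P) (i₂ : C ⇒ P) : Set₁ where
  field
    comm : Sq i₁ f i₂ g
    univ : (E : CwF) (u : B ⇒ E) (v : C ⇒ E) → Sq u f v g →
           Σ (P ⇒ E) λ h → Tri h i₁ u × Tri h i₂ v
             × ((h' : P ⇒ E) → Tri h' i₁ u → Tri h' i₂ v → raw h' ≈R raw h)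

data Kind : Set where
  kty ktm : Kind

-- a copy of I^ty : Free(Γ) → Free(Γ, A)   (the map sending Γ to Γ)
record GenTy : Set₁ where
  field
    Dom Cod : CwF
    Γd      : Ob Dom
    freeDom : IsFreeOb Dom Γd
    Γc      : Ob Cod
    Ac      : Ty Cod Γc
    freeCod : IsFreeTy Cod Γc Ac
    map     : Dom ⇒ Cod
    map-Γ   : ob (raw map) Γd ≡ Γc

-- a copy of I^tm : Free(Γ, A) → Free(Γ, A, a)   (sending Γ, A to Γ, A)
record GenTm : Set₁ where
  field
    Dom Cod : CwF
    Γd      : Ob Dom
    Ad      : Ty Dom Γd
    freeDom : IsFreeTy Dom Γd Ad
    Γc      : Ob Cod
    Ac      : Ty Cod Γc
    ac      : Tm Cod Γc Ac
    freeCod : IsFreeTm Cod Γc Ac ac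
    map     : Dom ⇒ Cod
    map-Γ   : ob (raw map) Γd ≡ Γc
    map-A   : ty (raw map) Ad ≅ Ac

record Gen (k : Kind) : Set₁ where
  field
    Dom Cod : CwF
    map     : Dom ⇒ Cod

GenOf : Kind → Set₁
GenOf kty = GenTy
GenOf ktm = GenTm

toGen : ∀ k → GenOf k → Gen k
toGen kty g = record { Dom = GenTy.Dom g ; Cod = GenTy.Cod g ; map = GenTy.map g }
toGen ktm g = record { Dom = GenTm.Dom g ; Cod = GenTm.Cod g ; map = GenTm.map g }

record IsBasicCellular {C D : CwF} (m : C ⇒ D) : Set₁ where
  field
    J       : Set
    kind    : J → Kind
    gen     : (j : J) → GenOf (kind j)
  G : (j : J) → Gen (kind j)
  G j = toGen (kind j) (gen j)
  field
    ∐Dom    : CwF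
    ιDom    : ∀ j → Gen.Dom (G j) ⇒ ∐Dom
    ∐Dom-cp : IsCoproduct (λ j → Gen.Dom (G j)) ∐Dom ιDom
    ∐Cod    : CwF
    ιCod    : ∀ j → Gen.Cod (G j) ⇒ ∐Cod
    ∐Cod-cp : IsCoproduct (λ j → Gen.Cod (G j)) ∐Cod ιCod
    ∐map    : ∐Dom ⇒ ∐Cod
    ∐map-ι  : ∀ j → Sq ∐map (ιDom j) (ιCod j) (Gen.map (G j))
    attach  : ∐Dom ⇒ C
    k       : ∐Cod ⇒ D
    pushout : IsPushout ∐map attach k m

record IsCellular (C : CwF) : Set₁ where
  field
    X       : ℕ → CwF
    X0-init : IsInitial (X zero)
    step    : ∀ n → X n ⇒ X (suc n)
    basic   : ∀ n → IsBasicCellular (step n)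
    ι       : ∀ n → X n ⇒ C
    ι-comm  : ∀ n → Tri (ι (suc n)) (step n) (ι n)
    colim   : (E : CwF) (τ : ∀ n → X n ⇒ E) → (∀ n → Tri (τ (suc n)) (step n) (τ n)) →
              Σ (C ⇒ E) λ h → (∀ n → Tri h (ι n) (τ n))
                × ((h' : C ⇒ E) → (∀ n → Tri h' (ι n) (τ n)) → raw h' ≈R raw h)

-- closed telescopes, indexed by the object  ◇.A₁.⋯.Aₙ  they determine
data Tel (C : CwF) : Ob C → Set where
  []  : Tel C (◇ C)
  _∷_ : ∀ {Γ} → Tel C Γ → (A : Ty C Γ) → Tel C (_▹_ C Γ A)

IsContextual : CwF → Set
IsContextual C = Bijective _≡_ _≡_ (proj₁ {A = Ob C} {B = Tel C})

-- Pairs of an object and a closed telescope for it form a CwF T with a strict projection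
-- π : T ⇒ C, and C is contextual as soon as π has a strict section s: strictness forces
-- s(◇.A₁.⋯.Aₙ) = (◇.A₁.⋯.Aₙ , A₁ ⋯ Aₙ) for every telescope, so telescopes are unique, and
-- s(Γ) provides one. Types and terms of T are those of C, so π lifts against I^ty and I^tm;
-- lifting properties are stable under coproducts and pushouts, hence π lifts against every
-- basic I-cellular map, and the section is built stage by stage along the cellular
-- presentation of C.
module Submission where

open import Defs
open import Data.Nat using (ℕ; zero; suc)
open import Data.Product using (Σ; _×_; _,_; proj₁; proj₂)
open import Relation.Binary.Bundles using (Setoid)
open import Relation.Binary.PropositionalEquality as P using (_≡_; refl; subst; cong)
open import Relation.Binary.HeterogeneousEquality as H using (_≅_; refl)
import Relation.Binary.Reasoning.Setoid as SetoidReasoning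
open CwF
open _⇒_
open RawMap
open _≈R_

module _ {C D : CwF} (R : RawMap C D) where
  hom-cong : ∀ {Γ Γ' Δ Δ'} → Γ ≡ Γ' → Δ ≡ Δ' → {σ : Hom C Γ Δ} {σ' : Hom C Γ' Δ'} →
             σ ≅ σ' → hom R σ ≅ hom R σ'
  hom-cong refl refl refl = refl

  ty-cong : ∀ {Γ Γ'} → Γ ≡ Γ' → {A : Ty C Γ} {A' : Ty C Γ'} → A ≅ A' → ty R A ≅ ty R A'
  ty-cong refl refl = refl

  tm-cong : ∀ {Γ Γ'} → Γ ≡ Γ' → {A : Ty C Γ} {A' : Ty C Γ'} → A ≅ A' →
            {t : Tm C Γ A} {t' : Tm C Γ' A'} → t ≅ t' → tm R t ≅ tm R t'
  tm-cong refl refl refl = refl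

module _ (E : CwF) where
  []T-congʳ : ∀ {Γ Γ' Δ} (A : Ty E Δ) → Γ ≡ Γ' → {σ : Hom E Γ Δ} {σ' : Hom E Γ' Δ} →
              σ ≅ σ' → _[_]T E A σ ≅ _[_]T E A σ'
  []T-congʳ A refl refl = refl

  ⟨,⟩-congʳ : ∀ {Γ Δ} {A : Ty E Γ} (σ : Hom E Δ Γ) {a b : Tm E Δ (_[_]T E A σ)} →
              a ≅ b → ⟨_,_⟩ E {A = A} σ a ≅ ⟨_,_⟩ E {A = A} σ b
  ⟨,⟩-congʳ σ refl = refl

  transport-ty : ∀ {Γ Δ} → Γ ≡ Δ → (B : Ty E Δ) → Σ (Ty E Γ) (_≅ B)
  transport-ty refl B = B , refl

  transport-tm : ∀ {Γ Δ} → Γ ≡ Δ → {A : Ty E Γ} {B : Ty E Δ} → A ≅ B →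
                 (b : Tm E Δ B) → Σ (Tm E Γ A) (_≅ b)
  transport-tm refl refl b = b , refl

id⇒ : (C : CwF) → C ⇒ C
id⇒ C = record
  { raw = record { ob = λ Γ → Γ ; hom = λ σ → σ ; ty = λ A → A ; tm = λ t → t }
  ; hom-id = refl ; hom-∘ = λ _ _ → refl ; ob-◇ = refl ; ty-[] = λ _ _ → refl
  ; tm-[] = λ _ _ → refl ; ob-▹ = λ _ _ → refl ; hom-p = refl ; tm-q = refl
  ; hom-⟨⟩ = λ _ _ → refl }

infixr 9 _∘⇒_
_∘⇒_ : ∀ {A B E} → B ⇒ E → A ⇒ B → A ⇒ E
_∘⇒_ {A} {B} {E} G F = record
  { raw    = raw G ∘R raw F
  ; hom-id = P.trans (cong (hom (raw G)) (hom-id F)) (hom-id G)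
  ; hom-∘  = λ σ τ → P.trans (cong (hom (raw G)) (hom-∘ F σ τ)) (hom-∘ G _ _)
  ; ob-◇   = P.trans (cong (ob (raw G)) (ob-◇ F)) (ob-◇ G)
  ; ty-[]  = λ X σ → P.trans (cong (ty (raw G)) (ty-[] F X σ)) (ty-[] G _ _)
  ; tm-[]  = λ {_} {_} {X} t σ →
      H.trans (tm-cong (raw G) refl (H.≡-to-≅ (ty-[] F X σ)) (tm-[] F t σ)) (tm-[] G _ _)
  ; ob-▹   = λ Γ X → P.trans (cong (ob (raw G)) (ob-▹ F Γ X)) (ob-▹ G _ _)
  ; hom-p  = λ {Γ} {X} → H.trans (hom-cong (raw G) (ob-▹ F Γ X) refl (hom-p F)) (hom-p G)
  ; tm-q   = λ {Γ} {X} →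
      H.trans (tm-cong (raw G) (ob-▹ F Γ X) (ty-[p] Γ X) (tm-q F)) (tm-q G)
  ; hom-⟨⟩ = λ {Γ} {_} {X} σ t →
      H.trans (hom-cong (raw G) refl (ob-▹ F Γ X) (hom-⟨⟩ F σ t))
        (H.trans (hom-⟨⟩ G (hom (raw F) σ) _)
                 (⟨,⟩-congʳ E (hom (raw G) (hom (raw F) σ)) (tm-subst-∘ σ t)))
  }
  where
  ty-[p] : ∀ Γ (X : Ty A Γ) →
           ty (raw F) (_[_]T A X (p A)) ≅ _[_]T B (ty (raw F) X) (p B {ob (raw F) Γ} {ty (raw F) X})
  ty-[p] Γ X = H.trans (H.≡-to-≅ (ty-[] F X (p A)))
                       ([]T-congʳ B (ty (raw F) X) (ob-▹ F Γ X) (hom-p F))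

  tm-subst-∘ : ∀ {Γ Δ} {X : Ty A Γ} (σ : Hom A Δ Γ) (t : Tm A Δ (_[_]T A X σ)) →
               subst (Tm E _) (ty-[] G (ty (raw F) X) (hom (raw F) σ))
                     (tm (raw G) (subst (Tm B _) (ty-[] F X σ) (tm (raw F) t)))
               ≅ subst (Tm E _) (P.trans (cong (ty (raw G)) (ty-[] F X σ))
                                         (ty-[] G (ty (raw F) X) (hom (raw F) σ)))
                       (tm (raw G) (tm (raw F) t))
  tm-subst-∘ {X = X} σ t = begin
    subst (Tm E _) e₂ (tm (raw G) (subst (Tm B _) e₁ (tm (raw F) t)))
      ≅⟨ H.≡-subst-removable (Tm E _) e₂ _ ⟩
    tm (raw G) (subst (Tm B _) e₁ (tm (raw F) t))
      ≅⟨ tm-cong (raw G) refl (H.≡-to-≅ (P.sym e₁)) (H.≡-subst-removable (Tm B _) e₁ _) ⟩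
    tm (raw G) (tm (raw F) t)
      ≅⟨ H.sym (H.≡-subst-removable (Tm E _) (P.trans (cong (ty (raw G)) e₁) e₂) _) ⟩
    subst (Tm E _) (P.trans (cong (ty (raw G)) e₁) e₂) (tm (raw G) (tm (raw F) t))
      ∎
    where
    open H.≅-Reasoning
    e₁ = ty-[] F X σ
    e₂ = ty-[] G (ty (raw F) X) (hom (raw F) σ)

module _ {C D : CwF} where
  ≈R-refl : {F : RawMap C D} → F ≈R F
  ≈R-refl = record { ob≈ = λ _ → refl ; hom≈ = λ _ → refl ; ty≈ = λ _ → refl ; tm≈ = λ _ → refl }

  ≈R-sym : {F G : RawMap C D} → F ≈R G → G ≈R F
  ≈R-sym e = record
    { ob≈ = λ Γ → P.sym (ob≈ e Γ) ; hom≈ = λ σ → H.sym (hom≈ e σ)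
    ; ty≈ = λ A → H.sym (ty≈ e A) ; tm≈ = λ t → H.sym (tm≈ e t) }

  ≈R-trans : {F G K : RawMap C D} → F ≈R G → G ≈R K → F ≈R K
  ≈R-trans e f = record
    { ob≈ = λ Γ → P.trans (ob≈ e Γ) (ob≈ f Γ)
    ; hom≈ = λ σ → H.trans (hom≈ e σ) (hom≈ f σ)
    ; ty≈ = λ A → H.trans (ty≈ e A) (ty≈ f A)
    ; tm≈ = λ t → H.trans (tm≈ e t) (tm≈ f t) }

≈R-setoid : CwF → CwF → Setoid _ _
≈R-setoid C D = record
  { Carrier = RawMap C D
  ; _≈_ = _≈R_
  ; isEquivalence = record { refl = ≈R-refl ; sym = ≈R-sym ; trans = ≈R-trans } }

module ≈R-Reasoning {C D : CwF} = SetoidReasoning (≈R-setoid C D)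

∘R-congˡ : ∀ {C D E} (K : RawMap D E) {F G : RawMap C D} → F ≈R G → (K ∘R F) ≈R (K ∘R G)
∘R-congˡ K e = record
  { ob≈  = λ Γ → cong (ob K) (ob≈ e Γ)
  ; hom≈ = λ {Γ} {Δ} σ → hom-cong K (ob≈ e Γ) (ob≈ e Δ) (hom≈ e σ)
  ; ty≈  = λ {Γ} A → ty-cong K (ob≈ e Γ) (ty≈ e A)
  ; tm≈  = λ {Γ} t → tm-cong K (ob≈ e Γ) (ty≈ e _) (tm≈ e t) }

∘R-congʳ : ∀ {C D E} {F G : RawMap D E} (K : RawMap C D) → F ≈R G → (F ∘R K) ≈R (G ∘R K)
∘R-congʳ K e = record
  { ob≈ = λ Γ → ob≈ e (ob K Γ) ; hom≈ = λ σ → hom≈ e (hom K σ)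
  ; ty≈ = λ A → ty≈ e (ty K A) ; tm≈ = λ t → tm≈ e (tm K t) }

initial-unique : ∀ {Z E} → IsInitial Z → (h h' : Z ⇒ E) → raw h ≈R raw h'
initial-unique {E = E} init h h' = ≈R-trans (proj₂ (init E) h) (≈R-sym (proj₂ (init E) h'))

module _ {F E : CwF} {Γ₀ : Ob F} where
  free-ob-unique : IsFreeOb F Γ₀ → (h h' : F ⇒ E) →
                   ob (raw h) Γ₀ ≡ ob (raw h') Γ₀ → raw h ≈R raw h'
  free-ob-unique free h h' eΓ = ≈R-trans (uniq h eΓ) (≈R-sym (uniq h' refl))
    where uniq = proj₂ (proj₂ (free E (ob (raw h') Γ₀)))

  free-ty-unique : {A₀ : Ty F Γ₀} → IsFreeTy F Γ₀ A₀ → (h h' : F ⇒ E) →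
                   ob (raw h) Γ₀ ≡ ob (raw h') Γ₀ → ty (raw h) A₀ ≅ ty (raw h') A₀ →
                   raw h ≈R raw h'
  free-ty-unique {A₀} free h h' eΓ eA = ≈R-trans (uniq h eΓ eA) (≈R-sym (uniq h' refl refl))
    where uniq = proj₂ (proj₂ (proj₂ (free E (ob (raw h') Γ₀) (ty (raw h') A₀))))

  free-tm-unique : {A₀ : Ty F Γ₀} {a₀ : Tm F Γ₀ A₀} → IsFreeTm F Γ₀ A₀ a₀ → (h h' : F ⇒ E) →
                   ob (raw h) Γ₀ ≡ ob (raw h') Γ₀ → ty (raw h) A₀ ≅ ty (raw h') A₀ →
                   tm (raw h) a₀ ≅ tm (raw h') a₀ → raw h ≈R raw h'
  free-tm-unique {A₀} {a₀} free h h' eΓ eA ea =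
    ≈R-trans (uniq h eΓ eA ea) (≈R-sym (uniq h' refl refl refl))
    where uniq = proj₂ (proj₂ (proj₂ (proj₂ (free E (ob (raw h') Γ₀) (ty (raw h') A₀) (tm (raw h') a₀)))))

coproduct-unique : ∀ {J : Set} {X : J → CwF} {P E} {ι : ∀ j → X j ⇒ P} →
                   IsCoproduct X P ι → (h h' : P ⇒ E) →
                   (∀ j → Sq h (ι j) h' (ι j)) → raw h ≈R raw h'
coproduct-unique {ι = ι} cp h h' agree = ≈R-trans (uniq h agree) (≈R-sym (uniq h' λ _ → ≈R-refl))
  where uniq = proj₂ (proj₂ (IsCoproduct.univ cp _ λ j → h' ∘⇒ ι j))

pushout-unique : ∀ {A B C P E} {f : A ⇒ B} {g : A ⇒ C} {i₁ : B ⇒ P} {i₂ : C ⇒ P} →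
                 IsPushout f g i₁ i₂ → (h h' : P ⇒ E) →
                 Sq h i₁ h' i₁ → Sq h i₂ h' i₂ → raw h ≈R raw h'
pushout-unique {i₁ = i₁} {i₂} po h h' agree₁ agree₂ =
  ≈R-trans (uniq h agree₁ agree₂) (≈R-sym (uniq h' ≈R-refl ≈R-refl))
  where
  uniq = proj₂ (proj₂ (proj₂ (IsPushout.univ po _ (h' ∘⇒ i₁) (h' ∘⇒ i₂)
                                (∘R-congˡ (raw h') (IsPushout.comm po)))))

colimit-unique : ∀ {C E} (cell : IsCellular C) (h h' : C ⇒ E) →
                 (∀ n → Sq h (IsCellular.ι cell n) h' (IsCellular.ι cell n)) → raw h ≈R raw h'
colimit-unique cell h h' agree = ≈R-trans (uniq h agree) (≈R-sym (uniq h' λ _ → ≈R-refl))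
  where
  open IsCellular cell
  uniq = proj₂ (proj₂ (colim _ (λ n → h' ∘⇒ ι n) λ n → ∘R-congˡ (raw h') (ι-comm n)))

infix 4 _⋔_
_⋔_ : ∀ {A B E C} → A ⇒ B → E ⇒ C → Set
_⋔_ {A} {B} {E} {C} m π =
  (z : A ⇒ E) (w : B ⇒ C) → Sq π z w m → Σ (B ⇒ E) λ g → Tri π g w × Tri g m z

basic-⋔ : ∀ {E C} (π : E ⇒ C) → (∀ k (G : GenOf k) → Gen.map (toGen k G) ⋔ π) →
          ∀ {A B} {m : A ⇒ B} → IsBasicCellular m → m ⋔ π
basic-⋔ {E} π gen-⋔ {B = B} {m = m} basic z w sq = h , πh≈w , hm≈z
  where
  open IsBasicCellular basic
  open ≈R-Reasoning

  sqⱼ : ∀ j → Sq π (z ∘⇒ attach ∘⇒ ιDom j) (w ∘⇒ k ∘⇒ ιCod j) (Gen.map (G j))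
  sqⱼ j = begin
    raw (π ∘⇒ z ∘⇒ attach ∘⇒ ιDom j)        ≈⟨ ∘R-congʳ (raw (attach ∘⇒ ιDom j)) sq ⟩
    raw (w ∘⇒ m ∘⇒ attach ∘⇒ ιDom j)        ≈⟨ ∘R-congˡ (raw w) (∘R-congʳ (raw (ιDom j))
                                                   (≈R-sym (IsPushout.comm pushout))) ⟩
    raw (w ∘⇒ k ∘⇒ ∐map ∘⇒ ιDom j)          ≈⟨ ∘R-congˡ (raw (w ∘⇒ k)) (∐map-ι j) ⟩
    raw (w ∘⇒ k ∘⇒ ιCod j ∘⇒ Gen.map (G j)) ∎

  lift : ∀ j → Σ (Gen.Cod (G j) ⇒ E) λ g →
               Tri π g (w ∘⇒ k ∘⇒ ιCod j) × Tri g (Gen.map (G j)) (z ∘⇒ attach ∘⇒ ιDom j)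
  lift j = gen-⋔ (kind j) (gen j) (z ∘⇒ attach ∘⇒ ιDom j) (w ∘⇒ k ∘⇒ ιCod j) (sqⱼ j)

  copair = IsCoproduct.univ ∐Cod-cp E λ j → proj₁ (lift j)

  u : ∐Cod ⇒ E
  u = proj₁ copair

  uιⱼ≈liftⱼ : ∀ j → Tri u (ιCod j) (proj₁ (lift j))
  uιⱼ≈liftⱼ = proj₁ (proj₂ copair)

  u∐map≈zattach : Sq u ∐map z attach
  u∐map≈zattach = coproduct-unique ∐Dom-cp (u ∘⇒ ∐map) (z ∘⇒ attach) λ j → begin
    raw (u ∘⇒ ∐map ∘⇒ ιDom j)             ≈⟨ ∘R-congˡ (raw u) (∐map-ι j) ⟩
    raw (u ∘⇒ ιCod j ∘⇒ Gen.map (G j))    ≈⟨ ∘R-congʳ (raw (Gen.map (G j))) (uιⱼ≈liftⱼ j) ⟩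
    raw (proj₁ (lift j) ∘⇒ Gen.map (G j)) ≈⟨ proj₂ (proj₂ (lift j)) ⟩
    raw (z ∘⇒ attach ∘⇒ ιDom j)           ∎

  πu≈wk : Sq π u w k
  πu≈wk = coproduct-unique ∐Cod-cp (π ∘⇒ u) (w ∘⇒ k) λ j →
    ≈R-trans (∘R-congˡ (raw π) (uιⱼ≈liftⱼ j)) (proj₁ (proj₂ (lift j)))

  glue = IsPushout.univ pushout E u z u∐map≈zattach

  h : B ⇒ E
  h = proj₁ glue

  hk≈u : Tri h k u
  hk≈u = proj₁ (proj₂ glue)

  hm≈z : Tri h m z
  hm≈z = proj₁ (proj₂ (proj₂ glue))

  πh≈w : Tri π h w
  πh≈w = pushout-unique pushout (π ∘⇒ h) w
    (≈R-trans (∘R-congˡ (raw π) hk≈u) πu≈wk)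
    (≈R-trans (∘R-congˡ (raw π) hm≈z) sq)

cellular-section : ∀ {E C} (π : E ⇒ C) →
                   (∀ {A B} {m : A ⇒ B} → IsBasicCellular m → m ⋔ π) →
                   IsCellular C → Σ (C ⇒ E) λ s → Tri π s (id⇒ C)
cellular-section {E} {C} π basic-⋔π cell = s , πs≈id
  where
  open IsCellular cell

  Lift : ℕ → Set
  Lift n = Σ (X n ⇒ E) λ τ → Tri π τ (ι n)

  extend : ∀ n (L : Lift n) → Σ (Lift (suc n)) λ L' → Tri (proj₁ L') (step n) (proj₁ L)
  extend n (τ , πτ≈ι) = (proj₁ filler , proj₁ (proj₂ filler)) , proj₂ (proj₂ filler)
    where
    filler = basic-⋔π (basic n) τ (ι (suc n)) (≈R-trans πτ≈ι (≈R-sym (ι-comm n)))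

  lifts : ∀ n → Lift n
  lifts zero    = τ₀ , initial-unique X0-init (π ∘⇒ τ₀) (ι zero)
    where
    τ₀ : X zero ⇒ E
    τ₀ = proj₁ (X0-init E)
  lifts (suc n) = proj₁ (extend n (lifts n))

  glue = colim E (λ n → proj₁ (lifts n)) λ n → proj₂ (extend n (lifts n))

  s : C ⇒ E
  s = proj₁ glue

  πs≈id : Tri π s (id⇒ C)
  πs≈id = colimit-unique cell (π ∘⇒ s) (id⇒ C) λ n →
    ≈R-trans (∘R-congˡ (raw π) (proj₁ (proj₂ glue) n)) (proj₂ (lifts n))

TelCwF : CwF → CwF
TelCwF C = record
  { Ob = Σ (Ob C) (Tel C)
  ; Hom = λ x y → Hom C (proj₁ x) (proj₁ y)
  ; id = id C ; _∘_ = _∘_ C ; idl = idl C ; idr = idr C ; ass = ass C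
  ; ◇ = (◇ C , []) ; ! = ! C ; !-η = !-η C
  ; Ty = λ x → Ty C (proj₁ x) ; _[_]T = _[_]T C ; [id]T = [id]T C ; [∘]T = [∘]T C
  ; Tm = λ x A → Tm C (proj₁ x) A ; _[_]t = _[_]t C ; [id]t = [id]t C ; [∘]t = [∘]t C
  ; _▹_ = λ x A → (_▹_ C (proj₁ x) A , proj₂ x ∷ A)
  ; p = p C ; q = q C ; ⟨_,_⟩ = ⟨_,_⟩ C ; ▹β₁ = ▹β₁ C ; ▹β₂ = ▹β₂ C ; ▹η = ▹η C }

π : (C : CwF) → TelCwF C ⇒ C
π C = record
  { raw = record { ob = proj₁ ; hom = λ σ → σ ; ty = λ A → A ; tm = λ t → t }
  ; hom-id = refl ; hom-∘ = λ _ _ → refl ; ob-◇ = refl ; ty-[] = λ _ _ → refl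
  ; tm-[] = λ _ _ → refl ; ob-▹ = λ _ _ → refl ; hom-p = refl ; tm-q = refl
  ; hom-⟨⟩ = λ _ _ → refl }

module _ (C : CwF) where
  private T = TelCwF C

  I-ty-⋔π : (G : GenTy) → GenTy.map G ⋔ π C
  I-ty-⋔π G z w sq = g , πg≈w , g-map≈z
    where
    open GenTy G
    x : Ob T
    x = ob (raw z) Γd

    x≡wΓ : proj₁ x ≡ ob (raw w) Γc
    x≡wΓ = P.trans (ob≈ sq Γd) (cong (ob (raw w)) map-Γ)

    B : Σ (Ty T x) (_≅ ty (raw w) Ac)
    B = transport-ty C x≡wΓ (ty (raw w) Ac)

    free = freeCod T x (proj₁ B)

    g : Cod ⇒ T
    g = proj₁ free

    gΓ : ob (raw g) Γc ≡ x
    gΓ = proj₁ (proj₂ free)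

    πg≈w : Tri (π C) g w
    πg≈w = free-ty-unique freeCod (π C ∘⇒ g) w
             (P.trans (cong proj₁ gΓ) x≡wΓ) (H.trans (proj₁ (proj₂ (proj₂ free))) (proj₂ B))

    g-map≈z : Tri g map z
    g-map≈z = free-ob-unique freeDom (g ∘⇒ map) z (P.trans (cong (ob (raw g)) map-Γ) gΓ)

  I-tm-⋔π : (G : GenTm) → GenTm.map G ⋔ π C
  I-tm-⋔π G z w sq = g , πg≈w , g-map≈z
    where
    open GenTm G
    x : Ob T
    x = ob (raw z) Γd

    x≡wΓ : proj₁ x ≡ ob (raw w) Γc
    x≡wΓ = P.trans (ob≈ sq Γd) (cong (ob (raw w)) map-Γ)

    zA≅wA : ty (raw z) Ad ≅ ty (raw w) Ac
    zA≅wA = H.trans (ty≈ sq Ad) (ty-cong (raw w) map-Γ map-A)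

    b : Σ (Tm T x (ty (raw z) Ad)) (_≅ tm (raw w) ac)
    b = transport-tm C x≡wΓ zA≅wA (tm (raw w) ac)

    free = freeCod T x (ty (raw z) Ad) (proj₁ b)

    g : Cod ⇒ T
    g = proj₁ free

    gΓ : ob (raw g) Γc ≡ x
    gΓ = proj₁ (proj₂ free)

    gA : ty (raw g) Ac ≅ ty (raw z) Ad
    gA = proj₁ (proj₂ (proj₂ free))

    ga : tm (raw g) ac ≅ proj₁ b
    ga = proj₁ (proj₂ (proj₂ (proj₂ free)))

    πg≈w : Tri (π C) g w
    πg≈w = free-tm-unique freeCod (π C ∘⇒ g) w
             (P.trans (cong proj₁ gΓ) x≡wΓ) (H.trans gA zA≅wA) (H.trans ga (proj₂ b))

    g-map≈z : Tri g map z
    g-map≈z = free-ty-unique freeDom (g ∘⇒ map) z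
                (P.trans (cong (ob (raw g)) map-Γ) gΓ) (H.trans (ty-cong (raw g) map-Γ map-A) gA)

  generator-⋔π : ∀ k (G : GenOf k) → Gen.map (toGen k G) ⋔ π C
  generator-⋔π kty = I-ty-⋔π
  generator-⋔π ktm = I-tm-⋔π

  ▹-cong : ∀ {x : Ob T} {Γ} {t : Tel C Γ} → x ≡ (Γ , t) →
           {B : Ty T x} {A : Ty C Γ} → B ≅ A → _▹_ T x B ≡ (_▹_ C Γ A , t ∷ A)
  ▹-cong refl refl = refl

  module _ (s : C ⇒ T) (πs≈id : Tri (π C) s (id⇒ C)) where
    section-ob : ∀ {Γ} (t : Tel C Γ) → ob (raw s) Γ ≡ (Γ , t)
    section-ob []      = ob-◇ s
    section-ob (t ∷ A) = P.trans (ob-▹ s _ A) (▹-cong (section-ob t) (ty≈ πs≈id A))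

    section⇒contextual : IsContextual C
    section⇒contextual = injective , surjective
      where
      injective : ∀ {x y : Ob T} → proj₁ x ≡ proj₁ y → x ≡ y
      injective {Γ , t} {.Γ , t'} refl = P.trans (P.sym (section-ob t)) (section-ob t')

      surjective : ∀ Γ → Σ (Ob T) λ x → ∀ {y} → y ≡ x → proj₁ y ≡ Γ
      surjective Γ = (Γ , subst (Tel C) (ob≈ πs≈id Γ) (proj₂ (ob (raw s) Γ))) , λ { refl → refl }

proposition15 : (C : CwF) → IsCellular C → IsContextual C
proposition15 C cell = section⇒contextual C (proj₁ section) (proj₂ section)
  where
  section : Σ (C ⇒ TelCwF C) λ s → Tri (π C) s (id⇒ C)
  section = cellular-section (π C) (basic-⋔ (π C) (generator-⋔π C)) cell
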